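{- Let $N = q^k n^2$ be an odd perfect number, where $q$ is a prime with $q \equiv k \equiv 1 \pmod 4$ and $\gcd(q,n)=1$. If $k=1$, then $$I(n^2) \leq 2 - \frac{5}{3q}.$$
   Context: For a positive integer $N$, $\sigma(N)$ denotes the sum of the positive divisors of $N$; $N$ is perfect if $\sigma(N)=2N$. The abundancy index of a positive integer $w$ is $I(w)=\sigma(w)/w$. -}

module Defs where

open import Data.Nat using (ℕ; zero; suc; _+_; _*_; _<_)
open import Data.Nat.Divisibility using (_∣?_)
open import Data.List using (List; filter)
open import Data.Nat.ListAction using (sum)
open import Data.List.Base using (upTo)
open import Data.Integer using (+_)
open import Data.Rational using (ℚ; _/_; 0ℚ)
open import Data.Product using (_×_)
open import Relation.Binary.PropositionalEquality using (_≡_)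

divisors : ℕ → List ℕ
divisors N = filter (λ d → d ∣? N) (Data.List.map suc (upTo N))

σ : ℕ → ℕ
σ N = sum (divisors N)

Perfect : ℕ → Set
Perfect N = (0 < N) × (σ N ≡ 2 * N)

-- abundancy index I(w) = σ(w)/w, as a rational (only meaningful for w ≥ 1;
-- the value at 0 is an arbitrary convention and is never used)
I : ℕ → ℚ
I zero = 0ℚ
I (suc w) = + σ (suc w) / suc w

-- With k = 1 we have N = q·m for m = n², and q ∤ m because q is prime and
-- coprime to n.  The divisors of m and their q-multiples are then distinct
-- divisors of N, so (1 + q)·σ(m) ≤ σ(N) = 2qm, i.e. I(m) ≤ 2q/(q + 1).  Since
-- q ≡ 1 (mod 4) and q ≠ 1 we have q ≥ 5, and for q ≥ 5
-- 2q/(q + 1) ≤ 2 − 5/(3q).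
module Submission where

open import Defs
open import Data.Nat as ℕ
  using (ℕ; zero; suc; NonZero; ≢-nonZero⁻¹; _+_; _*_; _^_; _%_; _∸_; z≤n; s≤s)
open import Data.Nat.Properties
open import Data.Nat.Divisibility
  using (_∣_; _∣?_; ∣-trans; ∣⇒≤; 0∣⇒≡0; ∣1⇒≡1; n∣m*n; m∣m*n; *-monoʳ-∣)
open import Data.Nat.DivMod using (m≡m%n+[m/n]*n) renaming (_/_ to _/ℕ_)
open import Data.Nat.Primality using (Prime; ¬prime[1])
open import Data.Nat.Coprimality using (Coprime; coprime-divisor)
open import Data.Nat.ListAction using (sum)
open import Data.Nat.ListAction.Properties using (sum-++; sum-↭)
open import Data.Nat.Tactic.RingSolver using (solve-∀)
open import Data.List using ([]; _∷_; _++_; map; upTo)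
open import Data.List.Membership.Propositional using (_∈_)
open import Data.List.Membership.Propositional.Properties
  using (∈-filter⁺; ∈-filter⁻; ∈-map⁺; ∈-map⁻; ∈-upTo⁺; ∈-∃++; ∈-++⁻)
open import Data.List.Relation.Binary.Subset.Propositional using (_⊆_)
open import Data.List.Relation.Binary.Disjoint.Propositional using (Disjoint)
open import Data.List.Relation.Binary.Permutation.Propositional.Properties
  using (shift; ∈-resp-↭)
open import Data.List.Relation.Unary.Any using (here; there)
import Data.List.Relation.Unary.All as All
open import Data.List.Relation.Unary.AllPairs using (_∷_)
open import Data.List.Relation.Unary.Unique.Propositional using (Unique)
import Data.List.Relation.Unary.Unique.Propositional.Properties as Unique
import Data.Integer as ℤ
open import Data.Integer using (+_)
open import Data.Integer.Properties using (pos-*)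
open import Data.Rational using (_≤_; _-_; -_; _/_; toℚᵘ) renaming (_*_ to _*ℚ_)
open import Data.Rational.Properties
  using (toℚᵘ-cancel-≤; toℚᵘ-fromℚᵘ; toℚᵘ-homo-+; toℚᵘ-homo-*; toℚᵘ-homo‿-)
import Data.Rational.Unnormalised as ℚᵘ
import Data.Rational.Unnormalised.Properties as ℚᵘ
open import Data.Product using (_,_; proj₂)
open import Data.Sum using (inj₁; inj₂)
open import Data.Empty using (⊥-elim)
open import Relation.Nullary using (¬_)
open import Relation.Binary.PropositionalEquality

∈-divisors⁻ : ∀ {d n} → d ∈ divisors n → d ∣ n
∈-divisors⁻ {n = n} d∈ = proj₂ (∈-filter⁻ (_∣? n) {xs = map suc (upTo n)} d∈)

∈-divisors⁺ : ∀ {d n} .{{_ : NonZero n}} → d ∣ n → d ∈ divisors n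
∈-divisors⁺ {zero}  {n} 0∣n = ⊥-elim (≢-nonZero⁻¹ n (0∣⇒≡0 0∣n))
∈-divisors⁺ {suc d} {n} d∣n =
  ∈-filter⁺ (_∣? n) (∈-map⁺ suc (∈-upTo⁺ (∣⇒≤ d∣n))) d∣n

divisors-unique : ∀ n → Unique (divisors n)
divisors-unique n = Unique.filter⁺ (_∣? n) (Unique.map⁺ suc-injective (Unique.upTo⁺ n))

sum-map-*ˡ : ∀ q xs → sum (map (q *_) xs) ≡ q * sum xs
sum-map-*ˡ q []       = sym (*-zeroʳ q)
sum-map-*ˡ q (x ∷ xs) = begin
  q * x + sum (map (q *_) xs) ≡⟨ cong (_+_ (q * x)) (sum-map-*ˡ q xs) ⟩
  q * x + q * sum xs          ≡⟨ *-distribˡ-+ q x (sum xs) ⟨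
  q * (x + sum xs)            ∎
  where open ≡-Reasoning

sum-mono-⊆ : ∀ {xs ys} → Unique xs → xs ⊆ ys → sum xs ℕ.≤ sum ys
sum-mono-⊆ {[]}     _              _     = z≤n
sum-mono-⊆ {x ∷ xs} (x∉xs ∷ xs-uniq) xs⊆ys with ∈-∃++ (xs⊆ys (here refl))
... | as , bs , refl = begin
  x + sum xs          ≤⟨ +-monoʳ-≤ x (sum-mono-⊆ xs-uniq xs⊆as++bs) ⟩
  x + sum (as ++ bs)  ≡⟨ sum-↭ (shift x as bs) ⟨
  sum (as ++ x ∷ bs)  ∎
  where
  open ≤-Reasoning
  xs⊆as++bs : xs ⊆ as ++ bs
  xs⊆as++bs v∈xs with ∈-resp-↭ (shift x as bs) (xs⊆ys (there v∈xs))
  ... | here refl = ⊥-elim (All.lookup x∉xs v∈xs refl)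
  ... | there v∈  = v∈

σ-*-lowerBound : ∀ q m .{{_ : NonZero q}} .{{_ : NonZero m}} →
        ¬ q ∣ m → (1 + q) * σ m ℕ.≤ σ (q * m)
σ-*-lowerBound q m q∤m = begin
  σ m + q * σ m             ≡⟨ cong (_+_ (σ m)) (sum-map-*ˡ q ds) ⟨
  σ m + sum (map (q *_) ds) ≡⟨ sum-++ ds (map (q *_) ds) ⟨
  sum (ds ++ map (q *_) ds) ≤⟨ sum-mono-⊆ unique ⊆divisors ⟩
  σ (q * m)                 ∎
  where
  open ≤-Reasoning
  instance _ = m*n≢0 q m
  ds = divisors m

  disjoint : Disjoint ds (map (q *_) ds)
  disjoint (v∈ds , v∈qds) with ∈-map⁻ (q *_) v∈qds
  ... | d , _ , refl = q∤m (∣-trans (m∣m*n d) (∈-divisors⁻ v∈ds))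

  unique : Unique (ds ++ map (q *_) ds)
  unique = Unique.++⁺ (divisors-unique m)
    (Unique.map⁺ (*-cancelˡ-≡ _ _ q) (divisors-unique m)) disjoint

  ⊆divisors : ds ++ map (q *_) ds ⊆ divisors (q * m)
  ⊆divisors v∈ with ∈-++⁻ ds v∈
  ... | inj₁ v∈ds  = ∈-divisors⁺ (∣-trans (∈-divisors⁻ v∈ds) (n∣m*n q))
  ... | inj₂ v∈qds with ∈-map⁻ (q *_) v∈qds
  ...   | d , d∈ds , refl = ∈-divisors⁺ (*-monoʳ-∣ q (∈-divisors⁻ d∈ds))

coprime∧∣^⇒∣1 : ∀ {m n} k → Coprime m n → m ∣ n ^ k → m ∣ 1
coprime∧∣^⇒∣1 zero    _   m∣1   = m∣1
coprime∧∣^⇒∣1 (suc k) m⊥n m∣nⁿ = coprime∧∣^⇒∣1 k m⊥n (coprime-divisor m⊥n m∣nⁿ)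

%4≡1∧≢1⇒5≤ : ∀ {n} → n % 4 ≡ 1 → n ≢ 1 → 5 ℕ.≤ n
%4≡1∧≢1⇒5≤ {n} n%4≡1 n≢1 with n /ℕ 4 | m≡m%n+[m/n]*n n 4
... | zero  | n≡ = ⊥-elim (n≢1 (trans n≡ (cong (_+ 0) n%4≡1)))
... | suc t | n≡ = subst (5 ℕ.≤_) (sym (trans n≡ (cong (_+ suc t * 4) n%4≡1))) (m≤m+n 5 (t * 4))

-- Clearing denominators in 2q/(q + 1) ≤ (6q − 5)/(3q) for q = 5 + r.
cross-bound : ∀ r s m → (6 + r) * s ℕ.≤ 2 * (5 + r) * m →
              s * (3 * (5 + r)) ℕ.≤ (25 + 6 * r) * m
cross-bound r s m h = *-cancelˡ-≤ (6 + r) (begin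
  (6 + r) * (s * (3 * (5 + r)))          ≡⟨ e₁ r s ⟩
  3 * (5 + r) * ((6 + r) * s)            ≤⟨ *-monoʳ-≤ (3 * (5 + r)) h ⟩
  3 * (5 + r) * (2 * (5 + r) * m)        ≡⟨ e₂ r m ⟩
  (150 + 60 * r + 6 * r * r) * m         ≤⟨ *-monoˡ-≤ m (+-monoˡ-≤ (6 * r * r) (+-monoʳ-≤ 150 (m≤m+n (60 * r) r))) ⟩
  (150 + (60 * r + r) + 6 * r * r) * m   ≡⟨ e₃ r m ⟩
  (6 + r) * ((25 + 6 * r) * m)           ∎)
  where
  open ≤-Reasoning
  e₁ : ∀ r s → (6 + r) * (s * (3 * (5 + r))) ≡ 3 * (5 + r) * ((6 + r) * s)
  e₁ = solve-∀
  e₂ : ∀ r m → 3 * (5 + r) * (2 * (5 + r) * m) ≡ (150 + 60 * r + 6 * r * r) * m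
  e₂ = solve-∀
  e₃ : ∀ r m → (150 + (60 * r + r) + 6 * r * r) * m ≡ (6 + r) * ((25 + 6 * r) * m)
  e₃ = solve-∀

pos-*-≤ : ∀ a b c d → a * b ℕ.≤ c * d → + a ℤ.* + b ℤ.≤ + c ℤ.* + d
pos-*-≤ a b c d ab≤cd = subst₂ ℤ._≤_ (pos-* a b) (pos-* c d) (ℤ.+≤+ ab≤cd)

≤2-5/[3q] : ∀ r s w → s * (3 * (5 + r)) ℕ.≤ (25 + 6 * r) * suc w →
            + s / suc w ≤ + 2 / 1 - (+ 5 / 3) *ℚ (+ 1 / (5 + r))
≤2-5/[3q] r s w h = toℚᵘ-cancel-≤ (begin
  toℚᵘ (+ s / suc w)                      ≃⟨ toℚᵘ-fromℚᵘ (ℚᵘ.mkℚᵘ (+ s) w) ⟩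
  ℚᵘ.mkℚᵘ (+ s) w                         ≤⟨ ℚᵘ.*≤* (pos-*-≤ s (1 * 3q) (2 * 3q ∸ 5) (suc w) cross) ⟩
  two ℚᵘ.- five/3 ℚᵘ.* 1/q                ≃⟨ rhs≃ ⟨
  toℚᵘ (+ 2 / 1 - (+ 5 / 3) *ℚ (+ 1 / q))  ∎)
  where
  open ℚᵘ.≤-Reasoning
  q = 5 + r
  3q = 3 * q
  two = ℚᵘ.mkℚᵘ (+ 2) 0
  five/3 = ℚᵘ.mkℚᵘ (+ 5) 2
  1/q = ℚᵘ.mkℚᵘ (+ 1) (4 + r)

  rhs≃ : toℚᵘ (+ 2 / 1 - (+ 5 / 3) *ℚ (+ 1 / q)) ℚᵘ.≃ two ℚᵘ.- five/3 ℚᵘ.* 1/q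
  rhs≃ = ℚᵘ.≃-trans (toℚᵘ-homo-+ (+ 2 / 1) (- ((+ 5 / 3) *ℚ (+ 1 / q))))
    (ℚᵘ.+-cong (toℚᵘ-fromℚᵘ two) (ℚᵘ.≃-trans (toℚᵘ-homo‿- ((+ 5 / 3) *ℚ (+ 1 / q)))
      (ℚᵘ.-‿cong (ℚᵘ.≃-trans (toℚᵘ-homo-* (+ 5 / 3) (+ 1 / q))
        (ℚᵘ.*-cong (toℚᵘ-fromℚᵘ five/3) (toℚᵘ-fromℚᵘ 1/q))))))

  -- two ℚᵘ.- five/3 ℚᵘ.* 1/q computes to the fraction (2·3q ∸ 5)/(1·3q).
  cross : s * (1 * 3q) ℕ.≤ (2 * 3q ∸ 5) * suc w
  cross = subst₂ ℕ._≤_ (cong (s *_) (sym (*-identityˡ 3q))) (cong (_* suc w) 25+6r≡6q∸5) h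
    where
    6q≡25+6r+5 : ∀ x → 2 * (3 * (5 + x)) ≡ 25 + 6 * x + 5
    6q≡25+6r+5 = solve-∀
    25+6r≡6q∸5 : 25 + 6 * r ≡ 2 * 3q ∸ 5
    25+6r≡6q∸5 = sym (trans (cong (_∸ 5) (6q≡25+6r+5 r)) (m+n∸n≡m (25 + 6 * r) 5))

σ-bound⇒I-bound : ∀ {q} m .{{_ : NonZero q}} .{{_ : NonZero m}} → 5 ℕ.≤ q →
                  (1 + q) * σ m ℕ.≤ 2 * q * m → I m ≤ + 2 / 1 - (+ 5 / 3) *ℚ (+ 1 / q)
σ-bound⇒I-bound (suc w) (s≤s (s≤s (s≤s (s≤s (s≤s (z≤n {r})))))) h =
  ≤2-5/[3q] r (σ (suc w)) w (cross-bound r (σ (suc w)) (suc w) h)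

lemma6 : (N q k n : ℕ) → .{{_ : NonZero q}} → Perfect N → N % 2 ≡ 1
    → N ≡ q ^ k * n ^ 2 → Prime q → q % 4 ≡ 1 → k % 4 ≡ 1 → Coprime q n
    → k ≡ 1 → I (n ^ 2) ≤ + 2 / 1 - (+ 5 / 3) *ℚ (+ 1 / q)
lemma6 N q k zero (N>0 , _) _ N≡ _ _ _ _ refl =
  ⊥-elim (<-irrefl (sym (trans N≡ (*-zeroʳ (q * 1)))) N>0)
lemma6 N q k n@(suc _) (_ , σN≡2N) _ N≡ q-prime q%4≡1 _ q⊥n refl =
  σ-bound⇒I-bound (n ^ 2) (%4≡1∧≢1⇒5≤ q%4≡1 q≢1) (begin
    (1 + q) * σ (n ^ 2) ≤⟨ σ-*-lowerBound q (n ^ 2) q∤n² ⟩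
    σ (q * n ^ 2)       ≡⟨ cong σ N≡qn² ⟨
    σ N                 ≡⟨ σN≡2N ⟩
    2 * N               ≡⟨ cong (2 *_) N≡qn² ⟩
    2 * (q * n ^ 2)     ≡⟨ *-assoc 2 q (n ^ 2) ⟨
    2 * q * n ^ 2       ∎)
  where
  open ≤-Reasoning
  q≢1 : q ≢ 1
  q≢1 refl = ¬prime[1] q-prime
  q∤n² : ¬ q ∣ n ^ 2
  q∤n² q∣n² = q≢1 (∣1⇒≡1 (coprime∧∣^⇒∣1 2 q⊥n q∣n²))
  N≡qn² : N ≡ q * n ^ 2
  N≡qn² = trans N≡ (cong (_* n ^ 2) (*-identityʳ q))
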